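{- Let $p>3$ be a prime and let $m$ be an integer with $0\le m\le p-2$. Then $$\sum_{s=0}^{m}H^{(2)}_s\equiv\sum_{s=0}^{p-m-2}H^{(2)}_s\pmod{p},$$ where $H^{(2)}_n=\sum_{k=1}^{n}\frac{1}{k^2}$ (so $H^{(2)}_0=0$).
   Context: For rational numbers $a,b$, $a\equiv b\pmod{p}$ means $a-b=pc$ for some rational $c$ whose denominator is not divisible by $p$. -}

module Defs where

open import Data.Nat as ℕ using (ℕ; zero; suc)
open import Data.Nat.Divisibility using (_∣_)
open import Data.Integer using (+_)
open import Data.Rational using (ℚ; _/_; _+_; _-_; _*_; 0ℚ; ↧ₙ_)
open import Data.Product using (∃; _×_)
open import Relation.Binary.PropositionalEquality using (_≡_)
open import Relation.Nullary using (¬_)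

H2 : ℕ → ℚ
H2 zero    = 0ℚ
H2 (suc n) = H2 n + (+ 1 / (suc n ℕ.* suc n))

sumH2 : ℕ → ℚ
sumH2 zero    = H2 zero
sumH2 (suc m) = sumH2 m + H2 (suc m)

_≡_[modℚ_] : ℚ → ℚ → ℕ → Set
a ≡ b [modℚ p ] = ∃ λ (c : ℚ) → (a - b ≡ (+ p / 1) * c) × ¬ (p ∣ ↧ₙ c)

{-# OPTIONS --safe #-}
-- If a + b = p then 1/a² − 1/b² = p · (b − a)/(a²b²), and the last factor is p-integral. So the
-- terms 1/k² and 1/(p−k)² of H (p−1) are congruent mod p, and summing this pairing gives
-- H x + H y ≡ H (p−1) whenever x + y = p − 1. Writing p = 2M + 1, the same pairing matches the
-- odd-denominator terms O of H (2M) with its even-denominator terms E, and H M = 4E; combined with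
-- H M + H M ≡ H (2M) = O + E this gives 3 (E + E) ≡ 0, hence H (p−1) ≡ 0, i.e. H x ≡ − H y for
-- x + y = p − 1. Summing once more, S x − S y ≡ − S (p−2) whenever x + y = p − 2; the case y = 0
-- gives S (p−2) ≡ 0, and so S m ≡ S (p−2−m).
module Submission where

open import Defs
open import Data.Nat as ℕ using (ℕ; zero; suc; _≤_; _<_; _∸_; _>_; z≤n; s≤s)
import Data.Nat.Properties as ℕ
open import Data.Nat.Divisibility using (_∣_; divides; ∣⇒≤; ∣-trans)
open import Data.Nat.Primality using (Prime; euclidsLemma; prime⇒irreducible; prime⇒nonTrivial)
open import Data.Nat.Tactic.RingSolver using () renaming (solve to solve-ℕ)
open import Data.Integer as ℤ using (+_)
import Data.Integer.Properties as ℤ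
open import Data.Integer.Tactic.RingSolver using (solve-∀)
open import Data.Integer.GCD using () renaming (gcd to gcdℤ)
open import Data.Rational as ℚ using (ℚ)
import Data.Rational.Properties as ℚ
open import Data.Rational.Unnormalised
  using (ℚᵘ; mkℚᵘ; ↧ₙ_; _≃_; *≡*; _+_; _*_; _-_; -_; _/_; 1/_; 0ℚᵘ; 1ℚᵘ; NonZero)
open import Data.Rational.Unnormalised.Properties
  using (≃-refl; ≃-sym; ≃-trans; ≃-setoid; +-cong; *-cong; -‿cong; +-identityˡ; +-identityʳ; +-congˡ; +-inverseʳ; *-inverseˡ; *-zeroʳ; *-identityˡ; *-distribˡ-+; +-congʳ; *-congˡ; *-congʳ)
open import Data.Rational.Unnormalised.Solver using (module +-*-Solver)
open +-*-Solver using (solve; _:=_; _:+_; _:*_; _:-_; :-_; con)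
open import Data.List using (_∷_; [])
open import Data.Empty using (⊥-elim)
open import Data.Product using (∃; _×_; _,_)
open import Data.Sum using (_⊎_; inj₁; inj₂; [_,_])
open import Function using (_∘_; flip)
open import Relation.Nullary using (¬_)
open import Relation.Binary using (Setoid; IsEquivalence)
open import Relation.Binary.PropositionalEquality using (_≡_; refl; sym; trans; cong; subst; module ≡-Reasoning)
import Relation.Binary.Reasoning.Setoid as SetoidReasoning

module ≃-Reasoning = SetoidReasoning ≃-setoid

partialSum : (ℕ → ℚᵘ) → ℕ → ℚᵘ
partialSum f zero    = 0ℚᵘ
partialSum f (suc n) = partialSum f n + f n

partialSum-neg : ∀ f n → partialSum (-_ ∘ f) n ≃ - partialSum f n
partialSum-neg f zero    = *≡* refl
partialSum-neg f (suc n) = begin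
  partialSum (-_ ∘ f) n + - f n ≈⟨ +-congˡ (- f n) (partialSum-neg f n) ⟩
  - partialSum f n + - f n      ≈⟨ solve 2 (λ s x → :- s :+ :- x := :- (s :+ x)) ≃-refl (partialSum f n) (f n) ⟩
  - (partialSum f n + f n)      ∎
  where open ≃-Reasoning

partialSum-scale : ∀ c {f g} → (∀ k → f k ≃ c * g k) → ∀ n → partialSum f n ≃ c * partialSum g n
partialSum-scale c         f≃cg zero    = ≃-sym (*-zeroʳ c)
partialSum-scale c {f} {g} f≃cg (suc n) = begin
  partialSum f n + f n         ≈⟨ +-cong (partialSum-scale c f≃cg n) (f≃cg n) ⟩
  c * partialSum g n + c * g n ≈⟨ solve 3 (λ c s x → c :* s :+ c :* x := c :* (s :+ x)) ≃-refl c (partialSum g n) (g n) ⟩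
  c * (partialSum g n + g n)   ∎
  where open ≃-Reasoning

partialSum-evens+odds : ∀ f n →
  partialSum f (n ℕ.+ n) ≃ partialSum (λ k → f (k ℕ.+ k)) n + partialSum (λ k → f (suc (k ℕ.+ k))) n
partialSum-evens+odds f zero    = *≡* refl
partialSum-evens+odds f (suc n) rewrite ℕ.+-suc n n = begin
  (partialSum f (n ℕ.+ n) + f (n ℕ.+ n)) + f (suc (n ℕ.+ n))
    ≈⟨ +-congˡ (f (suc (n ℕ.+ n))) (+-congˡ (f (n ℕ.+ n)) (partialSum-evens+odds f n)) ⟩
  ((E + O) + f (n ℕ.+ n)) + f (suc (n ℕ.+ n))
    ≈⟨ solve 4 (λ e o x y → ((e :+ o) :+ x) :+ y := (e :+ x) :+ (o :+ y)) ≃-refl E O (f (n ℕ.+ n)) (f (suc (n ℕ.+ n))) ⟩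
  (E + f (n ℕ.+ n)) + (O + f (suc (n ℕ.+ n))) ∎
  where
  open ≃-Reasoning
  E = partialSum (λ k → f (k ℕ.+ k)) n
  O = partialSum (λ k → f (suc (k ℕ.+ k))) n

-- Indices are shifted by one: H n = Σ_{k=1}^{n} 1/k² and S m = Σ_{s=0}^{m} H s.
invSq : ℕ → ℚᵘ
invSq k = + 1 / (suc k ℕ.* suc k)

H : ℕ → ℚᵘ
H = partialSum invSq

S : ℕ → ℚᵘ
S = partialSum (H ∘ suc)

_/1 : ℕ → ℚᵘ
n /1 = + n / 1

invSq-*-square : ∀ k → invSq k * (suc k /1 * suc k /1) ≃ 1ℚᵘ
invSq-*-square k = *≡* (cong (λ n → + suc n) (solve-ℕ (k ∷ [])))

/1-+ : ∀ m n → (m ℕ.+ n) /1 ≃ m /1 + n /1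
/1-+ m n = *≡* (trans (cong (ℤ._* + 1) (ℤ.pos-+ m n)) (identity (+ m) (+ n)))
  where
  identity : ∀ x y → (x ℤ.+ y) ℤ.* + 1 ≡ (x ℤ.* + 1 ℤ.+ y ℤ.* + 1) ℤ.* + 1
  identity = solve-∀

invSq-double : ∀ k → invSq k ≃ 4 /1 * invSq (suc (k ℕ.+ k))
invSq-double k = *≡* (cong (λ n → + suc n) (solve-ℕ (k ∷ [])))

toℚᵘ-H2 : ∀ n → ℚ.toℚᵘ (H2 n) ≃ H n
toℚᵘ-H2 zero    = *≡* refl
toℚᵘ-H2 (suc n) = ≃-trans (ℚ.toℚᵘ-homo-+ (H2 n) (+ 1 ℚ./ (suc n ℕ.* suc n)))
                          (+-cong (toℚᵘ-H2 n) (ℚ.toℚᵘ-fromℚᵘ (invSq n)))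

toℚᵘ-sumH2 : ∀ n → ℚ.toℚᵘ (sumH2 n) ≃ S n
toℚᵘ-sumH2 zero    = *≡* refl
toℚᵘ-sumH2 (suc n) = ≃-trans (ℚ.toℚᵘ-homo-+ (sumH2 n) (H2 (suc n)))
                             (+-cong (toℚᵘ-sumH2 n) (toℚᵘ-H2 (suc n)))

↧ₙ-fromℚᵘ-∣ : ∀ q → ℚ.↧ₙ (ℚ.fromℚᵘ q) ∣ ↧ₙ q
↧ₙ-fromℚᵘ-∣ (mkℚᵘ z d) = divides ℤ.∣ gcdℤ z (+ suc d) ∣ (begin
  suc d                                                   ≡⟨ cong ℤ.∣_∣ (ℚ.↧-/ z (suc d)) ⟨
  ℤ.∣ ℚ.↧ (z ℚ./ suc d) ℤ.* gcdℤ z (+ suc d) ∣            ≡⟨ ℤ.abs-* (ℚ.↧ (z ℚ./ suc d)) (gcdℤ z (+ suc d)) ⟩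
  ℚ.↧ₙ (z ℚ./ suc d) ℕ.* ℤ.∣ gcdℤ z (+ suc d) ∣            ≡⟨ ℕ.*-comm (ℚ.↧ₙ (z ℚ./ suc d)) _ ⟩
  ℤ.∣ gcdℤ z (+ suc d) ∣ ℕ.* ℚ.↧ₙ (z ℚ./ suc d)            ∎)
  where open ≡-Reasoning

even⊎odd : ∀ n → (∃ λ k → k ℕ.+ k ≡ n) ⊎ (∃ λ k → suc (k ℕ.+ k) ≡ n)
even⊎odd zero    = inj₁ (0 , refl)
even⊎odd (suc n) with even⊎odd n
... | inj₁ (k , k+k≡n)   = inj₂ (k , cong suc k+k≡n)
... | inj₂ (k , 1+k+k≡n) = inj₁ (suc k , cong suc (trans (ℕ.+-suc k k) 1+k+k≡n))

prime>2⇒odd : ∀ {p} → Prime p → 2 < p → ∃ λ M → suc (M ℕ.+ M) ≡ p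
prime>2⇒odd {p} p-prime 2<p with even⊎odd p
... | inj₂ odd        = odd
... | inj₁ (k , k+k≡p) with prime⇒irreducible p-prime {2} (divides k (trans (sym k+k≡p) (solve-ℕ (k ∷ []))))
...   | inj₁ ()
...   | inj₂ 2≡p = ⊥-elim (ℕ.<-irrefl 2≡p 2<p)

module ModPrime {p : ℕ} (p-prime : Prime p) where

  -- p-integrality of the stored, possibly unreduced, fraction
  record Integral (q : ℚᵘ) : Set where
    constructor mkIntegral
    field p∤denominator : ¬ p ∣ ↧ₙ q

  integral-+ : ∀ {q r} → Integral q → Integral r → Integral (q + r)
  integral-+ {mkℚᵘ _ _} {mkℚᵘ _ _} (mkIntegral p∤↧q) (mkIntegral p∤↧r) = mkIntegral λ p∣ →
    [ p∤↧q , p∤↧r ] (euclidsLemma _ _ p-prime p∣)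

  integral-* : ∀ {q r} → Integral q → Integral r → Integral (q * r)
  integral-* {mkℚᵘ _ _} {mkℚᵘ _ _} (mkIntegral p∤↧q) (mkIntegral p∤↧r) = mkIntegral λ p∣ →
    [ p∤↧q , p∤↧r ] (euclidsLemma _ _ p-prime p∣)

  integral-neg : ∀ {q} → Integral q → Integral (- q)
  integral-neg {mkℚᵘ _ _} (mkIntegral p∤↧q) = mkIntegral p∤↧q

  small-denominator⇒integral : ∀ z d → suc d < p → Integral (mkℚᵘ z d)
  small-denominator⇒integral z d d<p = mkIntegral λ p∣ → ℕ.<⇒≱ d<p (∣⇒≤ p∣)

  integer-integral : ∀ z → Integral (z / 1)
  integer-integral z = small-denominator⇒integral z 0 (ℕ.nonTrivial⇒n>1 p {{prime⇒nonTrivial p-prime}})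

  pMultiple : ℚᵘ → Set
  pMultiple q = ∃ λ c → q ≃ p /1 * c × Integral c

  pMultiple-resp-≃ : ∀ {q r} → q ≃ r → pMultiple q → pMultiple r
  pMultiple-resp-≃ q≃r (c , q≃pc , c-integral) = c , ≃-trans (≃-sym q≃r) q≃pc , c-integral

  pMultiple-0 : pMultiple 0ℚᵘ
  pMultiple-0 = 0ℚᵘ , ≃-sym (*-zeroʳ (p /1)) , integer-integral (+ 0)

  pMultiple-+ : ∀ {q r} → pMultiple q → pMultiple r → pMultiple (q + r)
  pMultiple-+ (c , q≃pc , c-integral) (d , r≃pd , d-integral) =
    c + d , ≃-trans (+-cong q≃pc r≃pd) (≃-sym (*-distribˡ-+ (p /1) c d)) , integral-+ c-integral d-integral

  pMultiple-* : ∀ k {q} → Integral k → pMultiple q → pMultiple (k * q)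
  pMultiple-* k k-integral (c , q≃pc , c-integral) =
    k * c , ≃-trans (*-congˡ {k} q≃pc) (solve 3 (λ k p c → k :* (p :* c) := p :* (k :* c)) ≃-refl k (p /1) c) ,
    integral-* k-integral c-integral

  infix 4 _≡ₚ_
  record _≡ₚ_ (a b : ℚᵘ) : Set where
    constructor mk≡ₚ
    field pMultiple-difference : pMultiple (a - b)

  ≃⇒≡ₚ : ∀ {a b} → a ≃ b → a ≡ₚ b
  ≃⇒≡ₚ {a} {b} a≃b = mk≡ₚ (pMultiple-resp-≃ (≃-sym (≃-trans (+-congˡ (- b) a≃b) (+-inverseʳ b))) pMultiple-0)

  ≡ₚ-sym : ∀ {a b} → a ≡ₚ b → b ≡ₚ a
  ≡ₚ-sym {a} {b} (mk≡ₚ a-b) = mk≡ₚ (pMultiple-resp-≃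
    (solve 2 (λ a b → con (ℤ.- + 1 / 1) :* (a :- b) := b :- a) ≃-refl a b)
    (pMultiple-* (ℤ.- + 1 / 1) (integer-integral (ℤ.- + 1)) a-b))

  ≡ₚ-trans : ∀ {a b c} → a ≡ₚ b → b ≡ₚ c → a ≡ₚ c
  ≡ₚ-trans {a} {b} {c} (mk≡ₚ a-b) (mk≡ₚ b-c) = mk≡ₚ
    (pMultiple-resp-≃ (solve 3 (λ a b c → (a :- b) :+ (b :- c) := a :- c) ≃-refl a b c) (pMultiple-+ a-b b-c))

  ≡ₚ-isEquivalence : IsEquivalence _≡ₚ_
  ≡ₚ-isEquivalence = record { refl = ≃⇒≡ₚ ≃-refl ; sym = ≡ₚ-sym ; trans = ≡ₚ-trans }

  ≡ₚ-setoid : Setoid _ _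
  ≡ₚ-setoid = record { isEquivalence = ≡ₚ-isEquivalence }

  module ≡ₚ-Reasoning = SetoidReasoning ≡ₚ-setoid

  +-cong-≡ₚ : ∀ {a b c d} → a ≡ₚ b → c ≡ₚ d → a + c ≡ₚ b + d
  +-cong-≡ₚ {a} {b} {c} {d} (mk≡ₚ a-b) (mk≡ₚ c-d) = mk≡ₚ (pMultiple-resp-≃
    (solve 4 (λ a b c d → (a :- b) :+ (c :- d) := (a :+ c) :- (b :+ d)) ≃-refl a b c d)
    (pMultiple-+ a-b c-d))

  +-congʳ-≡ₚ : ∀ a {c d} → c ≡ₚ d → a + c ≡ₚ a + d
  +-congʳ-≡ₚ a = +-cong-≡ₚ (≃⇒≡ₚ (≃-refl {a}))

  +-congˡ-≡ₚ : ∀ c {a b} → a ≡ₚ b → a + c ≡ₚ b + c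
  +-congˡ-≡ₚ c a≡b = +-cong-≡ₚ a≡b (≃⇒≡ₚ (≃-refl {c}))

  -‿cong-≡ₚ : ∀ {a b} → a ≡ₚ b → - a ≡ₚ - b
  -‿cong-≡ₚ {a} {b} a≡b with ≡ₚ-sym a≡b
  ... | mk≡ₚ b-a = mk≡ₚ (pMultiple-resp-≃ (solve 2 (λ a b → b :- a := :- a :- :- b) ≃-refl a b) b-a)

  +≡ₚ0⇒≡ₚ- : ∀ {a b} → a + b ≡ₚ 0ℚᵘ → a ≡ₚ - b
  +≡ₚ0⇒≡ₚ- {a} {b} (mk≡ₚ a+b) = mk≡ₚ (pMultiple-resp-≃ (solve 2 (λ a b → (a :+ b) :- con 0ℚᵘ := a :- :- b) ≃-refl a b) a+b)

  *-cancelˡ-≡ₚ : ∀ k .{{_ : NonZero k}} {a b} → Integral (1/ k) → k * a ≡ₚ k * b → a ≡ₚ b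
  *-cancelˡ-≡ₚ k {a} {b} k⁻¹-integral (mk≡ₚ ka-kb) = mk≡ₚ (pMultiple-resp-≃ k⁻¹[ka-kb]≃a-b (pMultiple-* (1/ k) k⁻¹-integral ka-kb))
    where
    open ≃-Reasoning
    k⁻¹[ka-kb]≃a-b : 1/ k * (k * a - k * b) ≃ a - b
    k⁻¹[ka-kb]≃a-b = begin
      1/ k * (k * a - k * b) ≈⟨ solve 4 (λ l k a b → l :* (k :* a :- k :* b) := (l :* k) :* (a :- b)) ≃-refl (1/ k) k a b ⟩
      (1/ k * k) * (a - b)   ≈⟨ *-congʳ (*-inverseˡ k) ⟩
      1ℚᵘ * (a - b)          ≈⟨ *-identityˡ (a - b) ⟩
      a - b                  ∎

  toℚᵘ-≡ₚ⇒≡[modℚ] : ∀ {a b} → ℚ.toℚᵘ a ≡ₚ ℚ.toℚᵘ b → a ≡ b [modℚ p ]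
  toℚᵘ-≡ₚ⇒≡[modℚ] {a} {b} (mk≡ₚ (c , toℚᵘa-toℚᵘb≃pc , mkIntegral p∤↧c)) =
    ℚ.fromℚᵘ c , ℚ.toℚᵘ-injective a-b≃pc , p∤↧c ∘ flip ∣-trans (↧ₙ-fromℚᵘ-∣ c)
    where
    open ≃-Reasoning
    a-b≃pc : ℚ.toℚᵘ (a ℚ.- b) ≃ ℚ.toℚᵘ (+ p ℚ./ 1 ℚ.* ℚ.fromℚᵘ c)
    a-b≃pc = begin
      ℚ.toℚᵘ (a ℚ.- b)                         ≈⟨ ℚ.toℚᵘ-homo-+ a (ℚ.- b) ⟩
      ℚ.toℚᵘ a + ℚ.toℚᵘ (ℚ.- b)                ≈⟨ +-congʳ (ℚ.toℚᵘ a) (ℚ.toℚᵘ-homo‿- b) ⟩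
      ℚ.toℚᵘ a - ℚ.toℚᵘ b                      ≈⟨ toℚᵘa-toℚᵘb≃pc ⟩
      p /1 * c                                  ≈⟨ *-cong (ℚ.toℚᵘ-fromℚᵘ (p /1)) (ℚ.toℚᵘ-fromℚᵘ c) ⟨
      ℚ.toℚᵘ (+ p ℚ./ 1) * ℚ.toℚᵘ (ℚ.fromℚᵘ c) ≈⟨ ℚ.toℚᵘ-homo-* (+ p ℚ./ 1) (ℚ.fromℚᵘ c) ⟨
      ℚ.toℚᵘ (+ p ℚ./ 1 ℚ.* ℚ.fromℚᵘ c)        ∎

  partialSum-reflect : ∀ {f g} n → (∀ i j → suc (i ℕ.+ j) ≡ n → f i ≡ₚ g j) →
    ∀ x y → x ℕ.+ y ≡ n → partialSum f x + partialSum g y ≡ₚ partialSum g n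
  partialSum-reflect n f≡g zero    y refl = ≃⇒≡ₚ (+-identityˡ (partialSum _ n))
  partialSum-reflect {f} {g} n f≡g (suc x) y 1+x+y≡n = begin
    (partialSum f x + f x) + partialSum g y ≈⟨ +-congˡ-≡ₚ (partialSum g y) (+-congʳ-≡ₚ (partialSum f x) (f≡g x y 1+x+y≡n)) ⟩
    (partialSum f x + g y) + partialSum g y ≈⟨ ≃⇒≡ₚ (solve 3 (λ s t x → (s :+ x) :+ t := s :+ (t :+ x)) ≃-refl (partialSum f x) (partialSum g y) (g y)) ⟩
    partialSum f x + partialSum g (suc y)   ≈⟨ partialSum-reflect n f≡g x (suc y) (trans (ℕ.+-suc x y) 1+x+y≡n) ⟩
    partialSum g n                          ∎
    where open ≡ₚ-Reasoning

module HarmonicModPrime {p : ℕ} (p-prime : Prime p) (3<p : 3 < p) where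
  open ModPrime p-prime

  2<p : 2 < p
  2<p = ℕ.<-trans (ℕ.n<1+n 2) 3<p

  invSq-integral : ∀ k → suc k < p → Integral (invSq k)
  invSq-integral k k<p = mkIntegral λ p∣ →
    [ p∤ , p∤ ] (euclidsLemma (suc k) (suc k) p-prime p∣)
    where
    p∤ : ¬ p ∣ suc k
    p∤ p∣ = ℕ.<⇒≱ k<p (∣⇒≤ p∣)

  invSq-reflect : ∀ i j → suc i ℕ.+ suc j ≡ p → invSq i ≡ₚ invSq j
  invSq-reflect i j a+b≡p = mk≡ₚ (c , x-y≃pc , c-integral)
    where
    open ≃-Reasoning
    A = suc i /1
    B = suc j /1
    x = invSq i
    y = invSq j
    c = (B - A) * x * y
    c-integral : Integral c
    c-integral = integral-* (integral-* (integral-+ (integer-integral (+ suc j)) (integral-neg (integer-integral (+ suc i))))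
      (invSq-integral i (subst (suc i <_) a+b≡p (ℕ.m<m+n (suc i) (s≤s z≤n)))))
      (invSq-integral j (subst (suc j <_) a+b≡p (ℕ.m<n+m (suc j) (s≤s z≤n))))
    x-y≃pc : x - y ≃ p /1 * c
    x-y≃pc = begin
      x - y                             ≈⟨ solve 2 (λ x y → x :- y := x :* con 1ℚᵘ :- y :* con 1ℚᵘ) ≃-refl x y ⟩
      x * 1ℚᵘ - y * 1ℚᵘ                 ≈⟨ +-cong (*-congˡ {x} (invSq-*-square j)) (-‿cong (*-congˡ {y} (invSq-*-square i))) ⟨
      x * (y * (B * B)) - y * (x * (A * A))
        ≈⟨ solve 4 (λ A B x y → x :* (y :* (B :* B)) :- y :* (x :* (A :* A)) := (A :+ B) :* ((B :- A) :* x :* y)) ≃-refl A B x y ⟩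
      (A + B) * c                       ≈⟨ *-congʳ (/1-+ (suc i) (suc j)) ⟨
      (suc i ℕ.+ suc j) /1 * c          ≡⟨ cong (λ n → n /1 * c) a+b≡p ⟩
      p /1 * c                          ∎

  H-reflect : ∀ x y → suc (x ℕ.+ y) ≡ p → H x + H y ≡ₚ H (x ℕ.+ y)
  H-reflect x y 1+x+y≡p = partialSum-reflect (x ℕ.+ y) invSq≡invSq x y refl
    where
    invSq≡invSq : ∀ i j → suc (i ℕ.+ j) ≡ x ℕ.+ y → invSq i ≡ₚ invSq j
    invSq≡invSq i j 1+i+j≡x+y =
      invSq-reflect i j (trans (cong suc (ℕ.+-suc i j)) (trans (cong suc 1+i+j≡x+y) 1+x+y≡p))

  H[2M]≡ₚ0 : ∀ M → suc (M ℕ.+ M) ≡ p → H (M ℕ.+ M) ≡ₚ 0ℚᵘ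
  H[2M]≡ₚ0 M 2M+1≡p = ≡ₚ-trans H[2M]≡E+E E+E≡0
    where
    open ≡ₚ-Reasoning
    -- O sums 1/(2k+1)² and E sums 1/(2k+2)² over k < M
    O = partialSum (λ k → invSq (k ℕ.+ k)) M
    E = partialSum (λ k → invSq (suc (k ℕ.+ k))) M
    O≡E : O ≡ₚ E
    O≡E = ≡ₚ-trans (≃⇒≡ₚ (≃-sym (+-identityʳ O))) (partialSum-reflect M odd≡even M 0 (ℕ.+-identityʳ M))
      where
      odd≡even : ∀ i j → suc (i ℕ.+ j) ≡ M → invSq (i ℕ.+ i) ≡ₚ invSq (suc (j ℕ.+ j))
      odd≡even i j 1+i+j≡M = invSq-reflect (i ℕ.+ i) (suc (j ℕ.+ j))
        (trans regroup (trans (cong (λ n → suc (n ℕ.+ n)) 1+i+j≡M) 2M+1≡p))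
        where
        regroup : suc (i ℕ.+ i) ℕ.+ suc (suc (j ℕ.+ j)) ≡ suc (suc (i ℕ.+ j) ℕ.+ suc (i ℕ.+ j))
        regroup = solve-ℕ (i ∷ j ∷ [])
    H[2M]≡E+E : H (M ℕ.+ M) ≡ₚ E + E
    H[2M]≡E+E = ≡ₚ-trans (≃⇒≡ₚ (partialSum-evens+odds invSq M)) (+-congˡ-≡ₚ E O≡E)
    H≃4E : H M ≃ 4 /1 * E
    H≃4E = partialSum-scale (4 /1) invSq-double M
    E+E≡0 : E + E ≡ₚ 0ℚᵘ
    E+E≡0 = *-cancelˡ-≡ₚ (3 /1) (small-denominator⇒integral (+ 1) 2 3<p) (begin
      3 /1 * (E + E)                  ≈⟨ ≃⇒≡ₚ (solve 1 (λ e → con (3 /1) :* (e :+ e) := (con (4 /1) :* e :+ con (4 /1) :* e) :- (e :+ e)) ≃-refl E) ⟩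
      (4 /1 * E + 4 /1 * E) - (E + E) ≈⟨ ≃⇒≡ₚ (+-congˡ (- (E + E)) (+-cong H≃4E H≃4E)) ⟨
      (H M + H M) - (E + E)           ≈⟨ +-congˡ-≡ₚ (- (E + E)) (≡ₚ-trans (H-reflect M M 2M+1≡p) H[2M]≡E+E) ⟩
      (E + E) - (E + E)               ≈⟨ ≃⇒≡ₚ (solve 1 (λ e → (e :+ e) :- (e :+ e) := con (3 /1) :* con 0ℚᵘ) ≃-refl E) ⟩
      3 /1 * 0ℚᵘ                      ∎)

  H[p-1]≡ₚ0 : ∀ n → suc n ≡ p → H n ≡ₚ 0ℚᵘ
  H[p-1]≡ₚ0 n 1+n≡p with prime>2⇒odd p-prime 2<p
  ... | M , 2M+1≡p rewrite ℕ.suc-injective (trans 1+n≡p (sym 2M+1≡p)) = H[2M]≡ₚ0 M 2M+1≡p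

  S-reflect : ∀ n → suc (suc n) ≡ p → ∀ x y → x ℕ.+ y ≡ n → S x - S y ≡ₚ - S n
  S-reflect n 2+n≡p x y x+y≡n = begin
    S x - S y                          ≈⟨ ≃⇒≡ₚ (+-congʳ (S x) (partialSum-neg (H ∘ suc) y)) ⟨
    S x + partialSum (-_ ∘ H ∘ suc) y  ≈⟨ partialSum-reflect n H≡-H x y x+y≡n ⟩
    partialSum (-_ ∘ H ∘ suc) n        ≈⟨ ≃⇒≡ₚ (partialSum-neg (H ∘ suc) n) ⟩
    - S n                              ∎
    where
    open ≡ₚ-Reasoning
    H≡-H : ∀ i j → suc (i ℕ.+ j) ≡ n → H (suc i) ≡ₚ - H (suc j)
    H≡-H i j 1+i+j≡n = +≡ₚ0⇒≡ₚ- (≡ₚ-trans (H-reflect (suc i) (suc j) 2+i+1+j≡p) (H[p-1]≡ₚ0 _ 2+i+1+j≡p))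
      where
      2+i+1+j≡p : suc (suc i ℕ.+ suc j) ≡ p
      2+i+1+j≡p = trans (cong (suc ∘ suc) (trans (ℕ.+-suc i j) 1+i+j≡n)) 2+n≡p

  S[p-2]≡ₚ0 : ∀ n → suc (suc n) ≡ p → S n ≡ₚ 0ℚᵘ
  S[p-2]≡ₚ0 n 2+n≡p = *-cancelˡ-≡ₚ (2 /1) (small-denominator⇒integral (+ 1) 1 2<p) (begin
    2 /1 * S n          ≈⟨ ≃⇒≡ₚ (solve 1 (λ s → con (2 /1) :* s := (s :- con 0ℚᵘ) :+ s) ≃-refl (S n)) ⟩
    (S n - S 0) + S n   ≈⟨ +-congˡ-≡ₚ (S n) (S-reflect n 2+n≡p n 0 (ℕ.+-identityʳ n)) ⟩
    - S n + S n         ≈⟨ ≃⇒≡ₚ (solve 1 (λ s → :- s :+ s := con (2 /1) :* con 0ℚᵘ) ≃-refl (S n)) ⟩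
    2 /1 * 0ℚᵘ          ∎)
    where open ≡ₚ-Reasoning

  S-symmetric : ∀ n → suc (suc n) ≡ p → ∀ m → m ≤ n → S m ≡ₚ S (n ∸ m)
  S-symmetric n 2+n≡p m m≤n = begin
    S m                           ≈⟨ ≃⇒≡ₚ (solve 2 (λ a b → a := (a :- b) :+ b) ≃-refl (S m) (S (n ∸ m))) ⟩
    (S m - S (n ∸ m)) + S (n ∸ m) ≈⟨ +-congˡ-≡ₚ (S (n ∸ m)) (S-reflect n 2+n≡p m (n ∸ m) (ℕ.m+[n∸m]≡n m≤n)) ⟩
    - S n + S (n ∸ m)             ≈⟨ +-congˡ-≡ₚ (S (n ∸ m)) (-‿cong-≡ₚ (S[p-2]≡ₚ0 n 2+n≡p)) ⟩
    - 0ℚᵘ + S (n ∸ m)             ≈⟨ ≃⇒≡ₚ (+-identityˡ (S (n ∸ m))) ⟩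
    S (n ∸ m)                     ∎
    where open ≡ₚ-Reasoning

lemma3p3 : (p : ℕ) → Prime p → p > 3 → (m : ℕ) → m ≤ p ∸ 2 →
    sumH2 m ≡ sumH2 (p ∸ m ∸ 2) [modℚ p ]
lemma3p3 p p-prime 3<p m m≤p∸2 = toℚᵘ-≡ₚ⇒≡[modℚ] (begin
  ℚ.toℚᵘ (sumH2 m)           ≈⟨ ≃⇒≡ₚ (toℚᵘ-sumH2 m) ⟩
  S m                        ≈⟨ S-symmetric (p ∸ 2) 2+[p∸2]≡p m m≤p∸2 ⟩
  S (p ∸ 2 ∸ m)              ≡⟨ cong S (∸-swap p 2 m) ⟩
  S (p ∸ m ∸ 2)              ≈⟨ ≃⇒≡ₚ (toℚᵘ-sumH2 (p ∸ m ∸ 2)) ⟨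
  ℚ.toℚᵘ (sumH2 (p ∸ m ∸ 2)) ∎)
  where
  open ModPrime p-prime
  open HarmonicModPrime p-prime 3<p
  open ≡ₚ-Reasoning
  2+[p∸2]≡p : suc (suc (p ∸ 2)) ≡ p
  2+[p∸2]≡p = ℕ.m+[n∸m]≡n (ℕ.<⇒≤ 2<p)
  ∸-swap : ∀ a b c → a ∸ b ∸ c ≡ a ∸ c ∸ b
  ∸-swap a b c = trans (ℕ.∸-+-assoc a b c) (trans (cong (a ∸_) (ℕ.+-comm b c)) (sym (ℕ.∸-+-assoc a c b)))
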